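{- Let $\mathbb N^*=\mathbb N\cup\{\infty\}$ be the $\{0,S,+,\cdot\}$-structure extending the standard model, where $S\infty=\infty+\infty=\infty\cdot\infty=\infty$, $0\cdot\infty=\infty\cdot0=0$, and $n+\infty=\infty+n=(n+1)\cdot\infty=\infty\cdot(n+1)=\infty$ for every $n\in\mathbb N$. Then: (1) $\mathbb N^*$ is a classical model of $\mathbf I\exists_1^+$; (2) the Kripke model $\mathbf K^*$ consisting of a single irreflexive node whose structure is $\mathbb N^*$ is a model of $\mathbf{BA}$.
   Context: $\mathbf I\exists_1^+$ is the classical first-order theory in $\{0,S,+,\cdot\}$ consisting of Robinson's $\mathbf Q$ (axioms $Sx\ne0$; $Sx=Sy\to x=y$; $x+0=x$; $x+Sy=S(x+y)$; $x\cdot0=0$; $x\cdot Sy=x\cdot y+x$; $x=0\lor\exists y(x=Sy)$) together with the induction schema (with parameters) for $\exists_1^+$ formulas, i.e. formulas $\exists\mathbf xA$ with $A$ quantifier-free and built from atomic formulas using only $\land,\lor$ (here $s<t$ abbreviates $\exists z(s+Sz=t)$). Basic Arithmetic $\mathbf{BA}$ is the theory of sequents $A\Rightarrow B$ in the language $\{0,S,+,\cdot\}$, where formulas are built from atomic formulas ($s=t$, $\top$, $\bot$) by $\land,\lor,\exists x$ and the former $\forall\mathbf x(A\to B)$ ($\mathbf x$ a finite, possibly empty, sequence of variables). Its axioms and rules are: Basic Predicate Calculus (axioms $A\Rightarrow A$; $A\Rightarrow\top$; $\bot\Rightarrow A$; $A\land(B\lor C)\Rightarrow(A\land B)\lor(A\land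 C)$; $A\land\exists xB\Rightarrow\exists x(A\land B)$ ($x$ not free in $A$); $\top\Rightarrow x=x$; $x=y\land A\Rightarrow A[x/y]$ ($A$ atomic); $\forall\mathbf x(A\to B)\land\forall\mathbf x(B\to C)\Rightarrow\forall\mathbf x(A\to C)$; $\forall\mathbf x(A\to B)\land\forall\mathbf x(A\to C)\Rightarrow\forall\mathbf x(A\to B\land C)$; $\forall\mathbf x(B\to A)\land\forall\mathbf x(C\to A)\Rightarrow\forall\mathbf x(B\lor C\to A)$; $\forall\mathbf x(A\to B)\Rightarrow\forall\mathbf x(A[\mathbf x/\mathbf t]\to B[\mathbf x/\mathbf t])$; $\forall\mathbf x(A\to B)\Rightarrow\forall\mathbf y(A\to B)$ (no variable of $\mathbf y$ free on the left); $\forall\mathbf yx(B\to A)\Rightarrow\forall\mathbf y(\exists xB\to A)$ ($x$ not free in $A$); rules: transitivity; $A\Rightarrow B\land C$ iff $A\Rightarrow B$ and $A\Rightarrow C$; $B\lor C\Rightarrow A$ iff $B\Rightarrow A$ and $C\Rightarrow A$; term substitution; $\exists xB\Rightarrow A$ iff $B\Rightarrow A$ ($x$ not free in $A$); from $A\land B\Rightarrow C$ infer $A\Rightarrow\forall\mathbf x(B\to C)$ (no variable of $\mathbf x$ free in $A$)), plus $Sx=0\Rightarrow\bot$; $Sx=Sy\Rightarrow x=y$; $x+0=x$; $x+Sy=S(x+y)$; $x\cdot0=0$; $x\cdot Sy=x\cdot y+x$; the induction axiom schema $\forall\mathbf yx(A\to A[x/Sx])\Rightarrow\forall\mathbf yx(A[x/0]\to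 A)$; and the induction rule (from $A\Rightarrow A[x/Sx]$ infer $A[x/0]\Rightarrow A$). Kripke semantics for basic logic: a Kripke model has a set of nodes with a transitive (not necessarily reflexive) relation $\prec$, each node $k$ carrying a classical structure; $k\Vdash\forall\mathbf x(A\to B)$ iff for all $k'\succ k$ and all $\mathbf c$ in the domain of $k'$, $k'\Vdash A[\mathbf c]$ implies $k'\Vdash B[\mathbf c]$; atomic formulas, $\land,\lor,\exists$ are forced locally as in the classical structure. A sequent $A\Rightarrow B$ is forced at $k$ iff for all $k'\succeq k$ and all assignments $\mathbf c$ in $k'$, $k'\Vdash A[\mathbf c]$ implies $k'\Vdash B[\mathbf c]$; a rule is forced at $k$ iff for every $k'\succeq k$, if $k'$ forces all premises then $k'$ forces the conclusion. A Kripke model is a model of $\mathbf{BA}$ if every node forces every axiom and rule of $\mathbf{BA}$. For the single irreflexive node of $\mathbf K^*$ this means: every formula $\forall\mathbf x(A\to B)$ is forced, and other formulas are forced as in classical satisfaction in $\mathbb N^*$. -}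

module Defs where

open import Data.Nat using (ℕ; zero; suc; _≡ᵇ_) renaming (_+_ to _+ℕ_; _*_ to _*ℕ_)
open import Data.Bool using (Bool; true; false; if_then_else_; _∨_)
open import Data.List using (List; []; _∷_; _++_; length)
open import Data.List.Membership.Propositional using (_∈_; _∉_)
open import Data.List.Relation.Unary.All using (All)
open import Data.Product using (_×_)
open import Data.Sum using (_⊎_)
open import Data.Empty using (⊥)
open import Data.Unit using (⊤)
open import Relation.Nullary using (¬_)
open import Relation.Binary.PropositionalEquality using (_≡_; _≢_)

data Term : Set where
  var  : ℕ → Term
  `0   : Term
  `S   : Term → Term
  _`+_ : Term → Term → Term
  _`·_ : Term → Term → Term

OccT : ℕ → Term → Set
OccT v (var w)  = v ≡ w
OccT v `0       = ⊥
OccT v (`S t)   = OccT v t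
OccT v (s `+ t) = OccT v s ⊎ OccT v t
OccT v (s `· t) = OccT v s ⊎ OccT v t

Subst : Set
Subst = ℕ → Term

substT : Subst → Term → Term
substT σ (var v)  = σ v
substT σ `0       = `0
substT σ (`S t)   = `S (substT σ t)
substT σ (s `+ t) = substT σ s `+ substT σ t
substT σ (s `· t) = substT σ s `· substT σ t

sg : ℕ → Term → Subst
sg x t v = if v ≡ᵇ x then t else var v

zipSub : List ℕ → List Term → Subst
zipSub (x ∷ xs) (t ∷ ts) v = if v ≡ᵇ x then t else zipSub xs ts v
zipSub _        _        v = var v

elem : ℕ → List ℕ → Bool
elem v []       = false
elem v (x ∷ xs) = (v ≡ᵇ x) ∨ elem v xs

_⟨_⟩ : Subst → List ℕ → Subst
(σ ⟨ xs ⟩) v = if elem v xs then var v else σ v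

record Ops (D : Set) : Set where
  field
    o0     : D
    oS     : D → D
    oplus  : D → D → D
    otimes : D → D → D

open Ops public

Env : Set → Set
Env D = ℕ → D

_[_↦_] : {D : Set} → Env D → ℕ → D → Env D
(ρ [ x ↦ d ]) v = if v ≡ᵇ x then d else ρ v

eval : {D : Set} → Ops D → Env D → Term → D
eval O ρ (var v)  = ρ v
eval O ρ `0       = o0 O
eval O ρ (`S t)   = oS O (eval O ρ t)
eval O ρ (s `+ t) = oplus O (eval O ρ s) (eval O ρ t)
eval O ρ (s `· t) = otimes O (eval O ρ s) (eval O ρ t)

data ℕ* : Set where
  fin : ℕ → ℕ*
  ∞   : ℕ*

S* : ℕ* → ℕ*
S* (fin n) = fin (suc n)
S* ∞       = ∞

_+*_ : ℕ* → ℕ* → ℕ*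
fin m +* fin n = fin (m +ℕ n)
fin m +* ∞     = ∞
∞     +* _     = ∞

_·*_ : ℕ* → ℕ* → ℕ*
fin m       ·* fin n = fin (m *ℕ n)
fin zero    ·* ∞     = fin zero
fin (suc m) ·* ∞     = ∞
∞           ·* fin zero    = fin zero
∞           ·* fin (suc n) = ∞
∞           ·* ∞     = ∞

ℕ*ops : Ops ℕ*
ℕ*ops = record { o0 = fin zero ; oS = S* ; oplus = _+*_ ; otimes = _·*_ }

data CForm : Set where
  ceq  : Term → Term → CForm
  c⊥   : CForm
  _c∧_ : CForm → CForm → CForm
  _c∨_ : CForm → CForm → CForm
  _c⇒_ : CForm → CForm → CForm
  c∀   : ℕ → CForm → CForm
  c∃   : ℕ → CForm → CForm

c¬ : CForm → CForm
c¬ A = A c⇒ c⊥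

substC : Subst → CForm → CForm
substC σ (ceq s t) = ceq (substT σ s) (substT σ t)
substC σ c⊥        = c⊥
substC σ (A c∧ B)  = substC σ A c∧ substC σ B
substC σ (A c∨ B)  = substC σ A c∨ substC σ B
substC σ (A c⇒ B)  = substC σ A c⇒ substC σ B
substC σ (c∀ x A)  = c∀ x (substC (σ ⟨ x ∷ [] ⟩) A)
substC σ (c∃ x A)  = c∃ x (substC (σ ⟨ x ∷ [] ⟩) A)

-- classical (Tarskian) satisfaction; ∨ and ∃ are read classically
-- (double negation), so that Sat is exactly classical truth.
Sat : {D : Set} → Ops D → CForm → Env D → Set
Sat O (ceq s t) ρ = eval O ρ s ≡ eval O ρ t
Sat O c⊥        ρ = ⊥
Sat O (A c∧ B)  ρ = Sat O A ρ × Sat O B ρ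
Sat O (A c∨ B)  ρ = ¬ (¬ Sat O A ρ × ¬ Sat O B ρ)
Sat O (A c⇒ B)  ρ = Sat O A ρ → Sat O B ρ
Sat {D} O (c∀ x A) ρ = (d : D) → Sat O A (ρ [ x ↦ d ])
Sat {D} O (c∃ x A) ρ = ¬ ((d : D) → ¬ Sat O A (ρ [ x ↦ d ]))

data PosQF : CForm → Set where
  pq-eq : ∀ s t → PosQF (ceq s t)
  pq-∧  : ∀ {A B} → PosQF A → PosQF B → PosQF (A c∧ B)
  pq-∨  : ∀ {A B} → PosQF A → PosQF B → PosQF (A c∨ B)

data IsE1+ : CForm → Set where
  e-base : ∀ {A} → PosQF A → IsE1+ A
  e-ex   : ∀ {A} x → IsE1+ A → IsE1+ (c∃ x A)

-- induction instance for A on x (other free variables are parameters)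
Ind : CForm → ℕ → CForm
Ind A x = (substC (sg x `0) A c∧ c∀ x (A c⇒ substC (sg x (`S (var x))) A)) c⇒ c∀ x A

module QVars where
  x y : Term
  x = var 0
  y = var 1

open QVars

data QAx : CForm → Set where
  q1 : QAx (c¬ (ceq (`S x) `0))
  q2 : QAx (ceq (`S x) (`S y) c⇒ ceq x y)
  q3 : QAx (ceq (x `+ `0) x)
  q4 : QAx (ceq (x `+ `S y) (`S (x `+ y)))
  q5 : QAx (ceq (x `· `0) `0)
  q6 : QAx (ceq (x `· `S y) ((x `· y) `+ x))
  q7 : QAx (ceq x `0 c∨ c∃ 1 (ceq x (`S y)))

ModelOfIE1+ : {D : Set} → Ops D → Set
ModelOfIE1+ O =
  (∀ φ → QAx φ → ∀ ρ → Sat O φ ρ) ×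
  (∀ A x → IsE1+ A → ∀ ρ → Sat O (Ind A x) ρ)

data BForm : Set where
  beq  : Term → Term → BForm
  b⊤   : BForm
  b⊥   : BForm
  _b∧_ : BForm → BForm → BForm
  _b∨_ : BForm → BForm → BForm
  b∃   : ℕ → BForm → BForm
  b∀   : List ℕ → BForm → BForm → BForm   -- ∀xs(A → B)

data IsAtomB : BForm → Set where
  at-eq : ∀ s t → IsAtomB (beq s t)
  at-⊤  : IsAtomB b⊤
  at-⊥  : IsAtomB b⊥

FreeB : ℕ → BForm → Set
FreeB v (beq s t)  = OccT v s ⊎ OccT v t
FreeB v b⊤         = ⊥
FreeB v b⊥         = ⊥
FreeB v (A b∧ B)   = FreeB v A ⊎ FreeB v B
FreeB v (A b∨ B)   = FreeB v A ⊎ FreeB v B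
FreeB v (b∃ x A)   = v ≢ x × FreeB v A
FreeB v (b∀ xs A B) = v ∉ xs × (FreeB v A ⊎ FreeB v B)

substB : Subst → BForm → BForm
substB σ (beq s t)   = beq (substT σ s) (substT σ t)
substB σ b⊤          = b⊤
substB σ b⊥          = b⊥
substB σ (A b∧ B)    = substB σ A b∧ substB σ B
substB σ (A b∨ B)    = substB σ A b∨ substB σ B
substB σ (b∃ x A)    = b∃ x (substB (σ ⟨ x ∷ [] ⟩) A)
substB σ (b∀ xs A B) = b∀ xs (substB (σ ⟨ xs ⟩) A) (substB (σ ⟨ xs ⟩) B)

FreeFor : Subst → BForm → Set
FreeFor σ (beq s t)   = ⊤
FreeFor σ b⊤          = ⊤
FreeFor σ b⊥          = ⊤
FreeFor σ (A b∧ B)    = FreeFor σ A × FreeFor σ B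
FreeFor σ (A b∨ B)    = FreeFor σ A × FreeFor σ B
FreeFor σ (b∃ x A)    =
  FreeFor (σ ⟨ x ∷ [] ⟩) A × (∀ v → FreeB v (b∃ x A) → ¬ OccT x (σ v))
FreeFor σ (b∀ xs A B) =
  FreeFor (σ ⟨ xs ⟩) A × FreeFor (σ ⟨ xs ⟩) B ×
  (∀ v → FreeB v (b∀ xs A B) → ∀ y → y ∈ xs → ¬ OccT y (σ v))

infix 4 _⇒_
data Seq : Set where
  _⇒_ : BForm → BForm → Seq

data BAx : Seq → Set where
  ax-id   : ∀ A → BAx (A ⇒ A)
  ax-⊤    : ∀ A → BAx (A ⇒ b⊤)
  ax-⊥    : ∀ A → BAx (b⊥ ⇒ A)
  ax-dist : ∀ A B C → BAx (A b∧ (B b∨ C) ⇒ (A b∧ B) b∨ (A b∧ C))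
  ax-∧∃   : ∀ A x B → ¬ FreeB x A → BAx (A b∧ b∃ x B ⇒ b∃ x (A b∧ B))
  ax-refl : ∀ x → BAx (b⊤ ⇒ beq (var x) (var x))
  ax-eq   : ∀ x y A → IsAtomB A →
            BAx (beq (var x) (var y) b∧ A ⇒ substB (sg x (var y)) A)
  ax-tr   : ∀ xs A B C → BAx (b∀ xs A B b∧ b∀ xs B C ⇒ b∀ xs A C)
  ax-∧    : ∀ xs A B C → BAx (b∀ xs A B b∧ b∀ xs A C ⇒ b∀ xs A (B b∧ C))
  ax-∨    : ∀ xs A B C → BAx (b∀ xs B A b∧ b∀ xs C A ⇒ b∀ xs (B b∨ C) A)
  ax-sub  : ∀ xs ts A B → length ts ≡ length xs →
            FreeFor (zipSub xs ts) A → FreeFor (zipSub xs ts) B →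
            BAx (b∀ xs A B ⇒ b∀ xs (substB (zipSub xs ts) A) (substB (zipSub xs ts) B))
  ax-gen  : ∀ xs ys A B → (∀ y → y ∈ ys → ¬ FreeB y (b∀ xs A B)) →
            BAx (b∀ xs A B ⇒ b∀ ys A B)
  ax-∃    : ∀ ys x B A → ¬ FreeB x A →
            BAx (b∀ (ys ++ x ∷ []) B A ⇒ b∀ ys (b∃ x B) A)
  ax-S0   : BAx (beq (`S x) `0 ⇒ b⊥)
  ax-SS   : BAx (beq (`S x) (`S y) ⇒ beq x y)
  ax-+0   : BAx (b⊤ ⇒ beq (x `+ `0) x)
  ax-+S   : BAx (b⊤ ⇒ beq (x `+ `S y) (`S (x `+ y)))
  ax-·0   : BAx (b⊤ ⇒ beq (x `· `0) `0)
  ax-·S   : BAx (b⊤ ⇒ beq (x `· `S y) ((x `· y) `+ x))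
  ax-ind  : ∀ ys x A →
            BAx (b∀ (ys ++ x ∷ []) A (substB (sg x (`S (var x))) A)
                 ⇒ b∀ (ys ++ x ∷ []) (substB (sg x `0) A) A)

data BRule : List Seq → Seq → Set where
  r-tr  : ∀ A B C → BRule ((A ⇒ B) ∷ (B ⇒ C) ∷ []) (A ⇒ C)
  r-∧I  : ∀ A B C → BRule ((A ⇒ B) ∷ (A ⇒ C) ∷ []) (A ⇒ B b∧ C)
  r-∧E₁ : ∀ A B C → BRule ((A ⇒ B b∧ C) ∷ []) (A ⇒ B)
  r-∧E₂ : ∀ A B C → BRule ((A ⇒ B b∧ C) ∷ []) (A ⇒ C)
  r-∨I  : ∀ A B C → BRule ((B ⇒ A) ∷ (C ⇒ A) ∷ []) (B b∨ C ⇒ A)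
  r-∨E₁ : ∀ A B C → BRule ((B b∨ C ⇒ A) ∷ []) (B ⇒ A)
  r-∨E₂ : ∀ A B C → BRule ((B b∨ C ⇒ A) ∷ []) (C ⇒ A)
  r-sub : ∀ A B x t → FreeFor (sg x t) A → FreeFor (sg x t) B →
          BRule ((A ⇒ B) ∷ []) (substB (sg x t) A ⇒ substB (sg x t) B)
  r-∃I  : ∀ x B A → ¬ FreeB x A → BRule ((B ⇒ A) ∷ []) (b∃ x B ⇒ A)
  r-∃E  : ∀ x B A → ¬ FreeB x A → BRule ((b∃ x B ⇒ A) ∷ []) (B ⇒ A)
  r-∀I  : ∀ xs A B C → (∀ x → x ∈ xs → ¬ FreeB x A) →
          BRule ((A b∧ B ⇒ C) ∷ []) (A ⇒ b∀ xs B C)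
  r-ind : ∀ x A → BRule ((A ⇒ substB (sg x (`S (var x))) A) ∷ [])
                        (substB (sg x `0) A ⇒ A)

-- Kripke models (constant domain; sufficient for K*)

record Kripke : Set₁ where
  field
    Node  : Set
    _≺_   : Node → Node → Set
    ≺-trans : ∀ {k l m} → k ≺ l → l ≺ m → k ≺ m
    Dom   : Set
    str   : Node → Ops Dom

module Forcing (M : Kripke) where
  open Kripke M

  Forces : Node → BForm → Env Dom → Set
  Forces k (beq s t)   ρ = eval (str k) ρ s ≡ eval (str k) ρ t
  Forces k b⊤          ρ = ⊤
  Forces k b⊥          ρ = ⊥
  Forces k (A b∧ B)    ρ = Forces k A ρ × Forces k B ρ
  Forces k (A b∨ B)    ρ = ¬ (¬ Forces k A ρ × ¬ Forces k B ρ)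
  Forces k (b∃ x A)    ρ = ¬ ((d : Dom) → ¬ Forces k A (ρ [ x ↦ d ]))
  Forces k (b∀ xs A B) ρ =
    ∀ k' → k ≺ k' → (ρ' : Env Dom) → (∀ v → v ∉ xs → ρ' v ≡ ρ v) →
    Forces k' A ρ' → Forces k' B ρ'

  _⪯_ : Node → Node → Set
  k ⪯ k' = k ≡ k' ⊎ k ≺ k'

  ForcesSeq : Node → Seq → Set
  ForcesSeq k (A ⇒ B) = ∀ k' → k ⪯ k' → (ρ : Env Dom) → Forces k' A ρ → Forces k' B ρ

  ForcesRule : Node → List Seq → Seq → Set
  ForcesRule k ps c = ∀ k' → k ⪯ k' → All (ForcesSeq k') ps → ForcesSeq k' c

ModelOfBA : Kripke → Set
ModelOfBA M = ∀ k →
  (∀ s → BAx s → ForcesSeq k s) × (∀ ps c → BRule ps c → ForcesRule k ps c)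
  where open Kripke M
        open Forcing M

K* : Kripke
K* = record
  { Node = ⊤
  ; _≺_ = λ _ _ → ⊥
  ; ≺-trans = λ ()
  ; Dom = ℕ*
  ; str = λ _ → ℕ*ops
  }

-- Forcing at the single irreflexive node of K* is classical truth in ℕ*, except that every
-- ∀xs(A → B) is forced vacuously.  Both parts therefore reduce to an ω-rule for positive
-- existential formulas A: if A(n) holds for every finite n, then A(∞) holds.
-- Truncation at M, which sends every value ≥ M to ∞, commutes with S, + and · on arguments
-- lying outside a gap (c, M), provided the finite values computed stay below M.  Choose levels
-- b₀ < b₁ < … so that every equation of A evaluated below bᵢ stays below bᵢ₊₁, and let
-- N = b_(2^k), k the number of existential quantifiers of A.  The k witnesses of A(N) miss one
-- of the gaps (bᵢ, bᵢ₊₁), the finite parameters lie below b₀ and N lies above bᵢ₊₁, so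
-- truncating at bᵢ₊₁ carries the witnessed instance A(N) to A(∞).

module Submission where

open import Defs
open import Data.Bool using (true; false; T)
open import Data.Bool.Properties using (∨-identityʳ)
open import Data.Empty using (⊥; ⊥-elim)
open import Data.List using (List; []; _∷_; _++_; length)
open import Data.List.Properties using (length-++)
open import Data.List.Relation.Unary.All using (All; []; _∷_)
open import Data.List.Relation.Unary.All.Properties using (++⁻)
open import Data.List.Membership.Propositional using (_∈_)
open import Data.Nat using (ℕ; zero; suc; _≡ᵇ_; _+_; _*_; _≤_; _<_; z≤n; s≤s; _^_; z<s; ≢-nonZero)
open import Data.Nat.Properties
open import Data.Product as Product using (_×_; _,_; proj₁; proj₂; ∃-syntax)
open import Data.Sum using (_⊎_; inj₁; inj₂)
open import Data.Unit using (⊤; tt)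
open import Function using (_∘_; id; flip)
open import Function.Bundles using (_⇔_; mk⇔; Equivalence)
open Equivalence using (to; from)
open import Relation.Nullary using (¬_; yes; no)
open import Relation.Nullary.Decidable using (map′; decidable-stable)
open import Relation.Nullary.Negation using (Stable; ¬¬-map; negated-stable; contradiction)
open import Relation.Binary.Definitions using (DecidableEquality)
open import Relation.Binary.PropositionalEquality

private variable
  D E : Set

update-elim : (P : D → Set) (ρ : Env D) → ∀ x d v →
              (v ≡ x → P d) → (v ≢ x → P (ρ v)) → P ((ρ [ x ↦ d ]) v)
update-elim P ρ x d v at-x off-x with v ≡ᵇ x in eq
... | true  = at-x (≡ᵇ⇒≡ v x (subst T (sym eq) _))
... | false = off-x (λ v≡x → subst T eq (≡⇒≡ᵇ v x v≡x))

update-elim₂ : (R : D → E → Set) (ρ : Env D) (τ : Env E) → ∀ x d e v →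
               (v ≡ x → R d e) → (v ≢ x → R (ρ v) (τ v)) →
               R ((ρ [ x ↦ d ]) v) ((τ [ x ↦ e ]) v)
update-elim₂ R ρ τ x d e v at-x off-x with v ≡ᵇ x in eq
... | true  = at-x (≡ᵇ⇒≡ v x (subst T (sym eq) _))
... | false = off-x (λ v≡x → subst T eq (≡⇒≡ᵇ v x v≡x))

update-same : (ρ : Env D) → ∀ x d → (ρ [ x ↦ d ]) x ≡ d
update-same ρ x d = update-elim (_≡ d) ρ x d x (λ _ → refl) (λ x≢x → ⊥-elim (x≢x refl))

update-other : (ρ : Env D) → ∀ x d v → v ≢ x → (ρ [ x ↦ d ]) v ≡ ρ v
update-other ρ x d v v≢x = update-elim (_≡ ρ v) ρ x d v (⊥-elim ∘ v≢x) (λ _ → refl)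

update-map : (f : D → E) (ρ : Env D) → ∀ x d → f ∘ (ρ [ x ↦ d ]) ≗ (f ∘ ρ) [ x ↦ f d ]
update-map f ρ x d v =
  update-elim₂ (λ a b → f a ≡ b) ρ (f ∘ ρ) x d (f d) v (λ _ → refl) (λ _ → refl)

update-self : (ρ : Env D) → ∀ x → ρ [ x ↦ ρ x ] ≗ ρ
update-self ρ x v = update-elim (_≡ ρ v) ρ x (ρ x) v (cong ρ ∘ sym) (λ _ → refl)

update-update : (ρ : Env D) → ∀ x d e → (ρ [ x ↦ d ]) [ x ↦ e ] ≗ ρ [ x ↦ e ]
update-update ρ x d e v =
  update-elim₂ _≡_ (ρ [ x ↦ d ]) ρ x e e v (λ _ → refl) (update-other ρ x d v)

eval-agree : (O : Ops D) (ρ τ : Env D) → ∀ t → (∀ v → OccT v t → ρ v ≡ τ v) →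
             eval O ρ t ≡ eval O τ t
eval-agree O ρ τ (var v)  agree = agree v refl
eval-agree O ρ τ `0       agree = refl
eval-agree O ρ τ (`S t)   agree = cong (oS O) (eval-agree O ρ τ t agree)
eval-agree O ρ τ (s `+ t) agree =
  cong₂ (oplus O) (eval-agree O ρ τ s (λ v → agree v ∘ inj₁)) (eval-agree O ρ τ t (λ v → agree v ∘ inj₂))
eval-agree O ρ τ (s `· t) agree =
  cong₂ (otimes O) (eval-agree O ρ τ s (λ v → agree v ∘ inj₁)) (eval-agree O ρ τ t (λ v → agree v ∘ inj₂))

eval-subst : (O : Ops D) (ρ : Env D) → ∀ σ t → eval O ρ (substT σ t) ≡ eval O (eval O ρ ∘ σ) t
eval-subst O ρ σ (var v)  = refl
eval-subst O ρ σ `0       = refl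
eval-subst O ρ σ (`S t)   = cong (oS O) (eval-subst O ρ σ t)
eval-subst O ρ σ (s `+ t) = cong₂ (oplus O) (eval-subst O ρ σ s) (eval-subst O ρ σ t)
eval-subst O ρ σ (s `· t) = cong₂ (otimes O) (eval-subst O ρ σ s) (eval-subst O ρ σ t)

bind-one : (σ : Subst) → ∀ y → σ ⟨ y ∷ [] ⟩ ≗ σ [ y ↦ var y ]
bind-one σ y v rewrite ∨-identityʳ (v ≡ᵇ y) =
  update-elim₂ _≡_ σ σ y (var v) (var y) v (cong var) (λ _ → refl)

classical-∨-map : ∀ {X X′ Y Y′ : Set} → (X → X′) → (Y → Y′) → ¬ (¬ X × ¬ Y) → ¬ (¬ X′ × ¬ Y′)
classical-∨-map f g ¬¬x∨y (¬x′ , ¬y′) = ¬¬x∨y (¬x′ ∘ f , ¬y′ ∘ g)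

classical-∃-map : ∀ {I : Set} {X Y : I → Set} → (∀ i → X i → Y i) → ¬ (∀ i → ¬ X i) → ¬ (∀ i → ¬ Y i)
classical-∃-map f ¬¬∃x ¬∃y = ¬¬∃x λ i → ¬∃y i ∘ f i

open Forcing K*

infix 4 _⊩_
_⊩_ : Env ℕ* → BForm → Set
ρ ⊩ A = Forces tt A ρ

eval* : Env ℕ* → Term → ℕ*
eval* = eval ℕ*ops

fin-injective : ∀ {m n} → fin m ≡ fin n → m ≡ n
fin-injective refl = refl

_≟*_ : DecidableEquality ℕ*
fin m ≟* fin n = map′ (cong fin) fin-injective (m ≟ n)
fin m ≟* ∞     = no λ ()
∞     ≟* fin n = no λ ()
∞     ≟* ∞     = yes refl

⊩-stable : ∀ A ρ → Stable (ρ ⊩ A)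
⊩-stable (beq s t)   ρ = decidable-stable (eval* ρ s ≟* eval* ρ t)
⊩-stable b⊤          ρ _ = tt
⊩-stable b⊥          ρ ¬¬⊥ = ¬¬⊥ id
⊩-stable (A b∧ B)    ρ ¬¬ab = ⊩-stable A ρ (¬¬-map proj₁ ¬¬ab) , ⊩-stable B ρ (¬¬-map proj₂ ¬¬ab)
⊩-stable (A b∨ B)    ρ = negated-stable
⊩-stable (b∃ x A)    ρ = negated-stable
⊩-stable (b∀ xs A B) ρ _ _ ()

⊩-agree : ∀ A {ρ τ} → (∀ v → FreeB v A → ρ v ≡ τ v) → ρ ⊩ A → τ ⊩ A
⊩-agree (beq s t) {ρ} {τ} agree s≡t =
  trans (sym (eval-agree ℕ*ops ρ τ s (λ v → agree v ∘ inj₁)))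
        (trans s≡t (eval-agree ℕ*ops ρ τ t (λ v → agree v ∘ inj₂)))
⊩-agree b⊤          agree _ = tt
⊩-agree (A b∧ B)    agree (a , b) =
  ⊩-agree A (λ v → agree v ∘ inj₁) a , ⊩-agree B (λ v → agree v ∘ inj₂) b
⊩-agree (A b∨ B)    agree =
  classical-∨-map (⊩-agree A (λ v → agree v ∘ inj₁)) (⊩-agree B (λ v → agree v ∘ inj₂))
⊩-agree (b∃ x A) {ρ} {τ} agree = classical-∃-map λ d →
  ⊩-agree A (λ v v∈A → update-elim₂ _≡_ ρ τ x d d v (λ _ → refl) (λ v≢x → agree v (v≢x , v∈A)))
⊩-agree (b∀ xs A B) agree _ _ ()

⊩-cong : ∀ A {ρ τ} → ρ ≗ τ → ρ ⊩ A → τ ⊩ A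
⊩-cong A ρ≗τ = ⊩-agree A (λ v _ → ρ≗τ v)

bind-one-eval : ∀ σ y d ρ A → (∀ v → FreeB v (b∃ y A) → ¬ OccT y (σ v)) →
                ∀ v → FreeB v A → eval* (ρ [ y ↦ d ]) ((σ ⟨ y ∷ [] ⟩) v) ≡ ((eval* ρ ∘ σ) [ y ↦ d ]) v
bind-one-eval σ y d ρ A capture-free v v∈A = begin
  eval* ρ′ ((σ ⟨ y ∷ [] ⟩) v)      ≡⟨ cong (eval* ρ′) (bind-one σ y v) ⟩
  eval* ρ′ ((σ [ y ↦ var y ]) v)   ≡⟨ update-map (eval* ρ′) σ y (var y) v ⟩
  ((eval* ρ′ ∘ σ) [ y ↦ ρ′ y ]) v  ≡⟨ update-elim₂ _≡_ (eval* ρ′ ∘ σ) (eval* ρ ∘ σ) y _ d v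
                                        y-bound σv-unchanged ⟩
  ((eval* ρ ∘ σ) [ y ↦ d ]) v      ∎
  where
    open ≡-Reasoning
    ρ′ = ρ [ y ↦ d ]
    y-bound : v ≡ y → ρ′ y ≡ d
    y-bound _ = update-same ρ y d
    σv-unchanged : v ≢ y → eval* ρ′ (σ v) ≡ eval* ρ (σ v)
    σv-unchanged v≢y = eval-agree ℕ*ops _ ρ (σ v) λ w w∈σv →
      update-other ρ y d w λ { refl → capture-free v (v≢y , v∈A) w∈σv }

⊩-subst : ∀ A σ ρ → FreeFor σ A → ρ ⊩ substB σ A ⇔ (eval* ρ ∘ σ) ⊩ A
⊩-subst (beq s t) σ ρ _ = mk⇔
  (λ e → trans (sym (eval-subst ℕ*ops ρ σ s)) (trans e (eval-subst ℕ*ops ρ σ t)))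
  (λ e → trans (eval-subst ℕ*ops ρ σ s) (trans e (sym (eval-subst ℕ*ops ρ σ t))))
⊩-subst b⊤ σ ρ _ = mk⇔ id id
⊩-subst b⊥ σ ρ _ = mk⇔ id id
⊩-subst (A b∧ B) σ ρ (ffA , ffB) = mk⇔
  (Product.map (to (⊩-subst A σ ρ ffA)) (to (⊩-subst B σ ρ ffB)))
  (Product.map (from (⊩-subst A σ ρ ffA)) (from (⊩-subst B σ ρ ffB)))
⊩-subst (A b∨ B) σ ρ (ffA , ffB) = mk⇔
  (classical-∨-map (to (⊩-subst A σ ρ ffA)) (to (⊩-subst B σ ρ ffB)))
  (classical-∨-map (from (⊩-subst A σ ρ ffA)) (from (⊩-subst B σ ρ ffB)))
⊩-subst (b∃ y A) σ ρ (ffA , capture-free) = mk⇔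
  (classical-∃-map λ d → ⊩-agree A (bind-one-eval σ y d ρ A capture-free) ∘ to (IH d))
  (classical-∃-map λ d → from (IH d) ∘ ⊩-agree A λ v v∈A →
    sym (bind-one-eval σ y d ρ A capture-free v v∈A))
  where IH = λ d → ⊩-subst A (σ ⟨ y ∷ [] ⟩) (ρ [ y ↦ d ]) ffA
⊩-subst (b∀ xs A B) σ ρ _ = mk⇔ (λ _ _ ()) (λ _ _ ())

Local : Subst → Set
Local σ = ∀ v w → OccT w (σ v) → w ≡ v

local-bind : ∀ σ xs → Local σ → Local (σ ⟨ xs ⟩)
local-bind σ xs local v w with elem v xs
... | true  = id
... | false = local v w

local-sg : ∀ x t → (∀ w → OccT w t → w ≡ x) → Local (sg x t)
local-sg x t only-x v w =
  update-elim (λ u → OccT w u → w ≡ v) var x t v (λ v≡x w∈t → trans (only-x w w∈t) (sym v≡x)) (λ _ → id)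

local⇒freeFor : ∀ A σ → Local σ → FreeFor σ A
local⇒freeFor (beq s t)   σ local = tt
local⇒freeFor b⊤          σ local = tt
local⇒freeFor b⊥          σ local = tt
local⇒freeFor (A b∧ B)    σ local = local⇒freeFor A σ local , local⇒freeFor B σ local
local⇒freeFor (A b∨ B)    σ local = local⇒freeFor A σ local , local⇒freeFor B σ local
local⇒freeFor (b∃ y A)    σ local =
  local⇒freeFor A _ (local-bind σ (y ∷ []) local) , λ v v∈∃ y∈σv → proj₁ v∈∃ (sym (local v y y∈σv))
local⇒freeFor (b∀ xs A B) σ local =
  local⇒freeFor A _ (local-bind σ xs local) , local⇒freeFor B _ (local-bind σ xs local) ,
  λ v v∈∀ y y∈xs y∈σv → proj₁ v∈∀ (subst (_∈ xs) (local v y y∈σv) y∈xs)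

-- sg x t is definitionally var [ x ↦ t ].
eval-sg : ∀ ρ x t → eval* ρ ∘ sg x t ≗ ρ [ x ↦ eval* ρ t ]
eval-sg ρ = update-map (eval* ρ) var

S*≢0 : ∀ a → S* a ≢ fin 0
S*≢0 (fin n) ()
S*≢0 ∞       ()

S*-injective : ∀ a b → S* a ≡ S* b → a ≡ b
S*-injective (fin m) (fin n) refl = refl
S*-injective ∞       ∞       refl = refl

zero-or-S* : ∀ a → a ≡ fin 0 ⊎ ∃[ b ] a ≡ S* b
zero-or-S* (fin zero)    = inj₁ refl
zero-or-S* (fin (suc n)) = inj₂ (fin n , refl)
zero-or-S* ∞             = inj₂ (∞ , refl)

+*-identityʳ : ∀ a → a +* fin 0 ≡ a
+*-identityʳ (fin m) = cong fin (+-identityʳ m)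
+*-identityʳ ∞       = refl

+*-suc : ∀ a b → a +* S* b ≡ S* (a +* b)
+*-suc (fin m) (fin n) = cong fin (+-suc m n)
+*-suc (fin m) ∞       = refl
+*-suc ∞       b       = refl

+*-∞ʳ : ∀ a → a +* ∞ ≡ ∞
+*-∞ʳ (fin m) = refl
+*-∞ʳ ∞       = refl

·*-zeroˡ : ∀ a → fin 0 ·* a ≡ fin 0
·*-zeroˡ (fin n) = refl
·*-zeroˡ ∞       = refl

·*-zeroʳ : ∀ a → a ·* fin 0 ≡ fin 0
·*-zeroʳ (fin m) = cong fin (*-zeroʳ m)
·*-zeroʳ ∞       = refl

·*-suc : ∀ a b → a ·* S* b ≡ (a ·* b) +* a
·*-suc (fin m)       (fin n)       = cong fin (trans (*-suc m n) (+-comm m (m * n)))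
·*-suc (fin zero)    ∞             = refl
·*-suc (fin (suc m)) ∞             = refl
·*-suc ∞             (fin zero)    = refl
·*-suc ∞             (fin (suc n)) = refl
·*-suc ∞             ∞             = refl

·*-∞ˡ : ∀ {b} → b ≢ fin 0 → ∞ ·* b ≡ ∞
·*-∞ˡ {fin zero}    b≢0 = ⊥-elim (b≢0 refl)
·*-∞ˡ {fin (suc n)} _   = refl
·*-∞ˡ {∞}           _   = refl

·*-∞ʳ : ∀ {a} → a ≢ fin 0 → a ·* ∞ ≡ ∞
·*-∞ʳ {fin zero}    a≢0 = ⊥-elim (a≢0 refl)
·*-∞ʳ {fin (suc n)} _   = refl
·*-∞ʳ {∞}           _   = refl

truncate : ℕ → ℕ* → ℕ*
truncate M (fin k) with k <? M
... | yes _ = fin k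
... | no  _ = ∞
truncate M ∞ = ∞

truncate-fin : ∀ {M k} → k < M → truncate M (fin k) ≡ fin k
truncate-fin {M} {k} k<M with k <? M
... | yes _   = refl
... | no  k≮M = contradiction k<M k≮M

truncate-≢0 : ∀ {M d} → d ≢ fin 0 → truncate M d ≢ fin 0
truncate-≢0 {M} {fin k} k≢0 with k <? M
... | yes _ = k≢0
... | no  _ = λ ()
truncate-≢0 {M} {∞} _ = λ ()

data Large (M : ℕ) : ℕ* → Set where
  fin-large : ∀ {k} → M ≤ k → Large M (fin k)
  ∞-large   : Large M ∞

truncate-large : ∀ {M d} → Large M d → truncate M d ≡ ∞
truncate-large {M} (fin-large {k} M≤k) with k <? M
... | yes k<M = contradiction M≤k (<⇒≱ k<M)
... | no  _   = refl
truncate-large ∞-large = refl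

large-S : ∀ {M a} → Large M a → Large M (S* a)
large-S (fin-large M≤k) = fin-large (m≤n⇒m≤1+n M≤k)
large-S ∞-large         = ∞-large

large-+ˡ : ∀ {M a} → Large M a → ∀ b → Large M (a +* b)
large-+ˡ (fin-large M≤k) (fin n) = fin-large (m≤n⇒m≤n+o n M≤k)
large-+ˡ (fin-large M≤k) ∞       = ∞-large
large-+ˡ ∞-large         b       = ∞-large

large-+ʳ : ∀ {M b} a → Large M b → Large M (a +* b)
large-+ʳ (fin m) (fin-large M≤k) = fin-large (m≤n⇒m≤o+n m M≤k)
large-+ʳ (fin m) ∞-large         = ∞-large
large-+ʳ ∞       _               = ∞-large

large-·ˡ : ∀ {M a b} → Large M a → b ≢ fin 0 → Large M (a ·* b)
large-·ˡ {b = fin zero}    _                          b≢0 = ⊥-elim (b≢0 refl)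
large-·ˡ {b = fin (suc n)} (fin-large {k} M≤k)        _   = fin-large (≤-trans M≤k (m≤m*n k (suc n)))
large-·ˡ {b = fin (suc n)} ∞-large                    _   = ∞-large
large-·ˡ {b = ∞}           (fin-large {zero} M≤0)     _   = fin-large M≤0
large-·ˡ {b = ∞}           (fin-large {suc k} _)      _   = ∞-large
large-·ˡ {b = ∞}           ∞-large                    _   = ∞-large

large-·ʳ : ∀ {M a b} → a ≢ fin 0 → Large M b → Large M (a ·* b)
large-·ʳ {a = fin zero}    a≢0 _                      = ⊥-elim (a≢0 refl)
large-·ʳ {a = fin (suc m)} _   (fin-large {k} M≤k)    = fin-large (≤-trans M≤k (m≤n*m k (suc m)))
large-·ʳ {a = fin (suc m)} _   ∞-large                = ∞-large
large-·ʳ {a = ∞}           _   (fin-large {zero} M≤0) = fin-large M≤0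
large-·ʳ {a = ∞}           _   (fin-large {suc k} _)  = ∞-large
large-·ʳ {a = ∞}           _   ∞-large                = ∞-large

data OutsideGap (c M : ℕ) : ℕ* → Set where
  below : ∀ {k} → k ≤ c → OutsideGap c M (fin k)
  above : ∀ {d} → Large M d → OutsideGap c M d

outsideGap-weaken : ∀ {c c′ M d} → c ≤ c′ → OutsideGap c M d → OutsideGap c′ M d
outsideGap-weaken c≤c′ (below k≤c) = below (≤-trans k≤c c≤c′)
outsideGap-weaken c≤c′ (above l)   = above l

truncate-S : ∀ {c M a} → OutsideGap c M a → suc c < M →
             OutsideGap (suc c) M (S* a) × truncate M (S* a) ≡ S* (truncate M a)
truncate-S (below k≤c) 1+c<M =
  below (s≤s k≤c) ,
  trans (truncate-fin (≤-<-trans (s≤s k≤c) 1+c<M))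
        (cong S* (sym (truncate-fin (≤-<-trans (m≤n⇒m≤1+n k≤c) 1+c<M))))
truncate-S (above l) _ =
  above (large-S l) , trans (truncate-large (large-S l)) (cong S* (sym (truncate-large l)))

truncate-+ : ∀ {c₁ c₂ M a b} → OutsideGap c₁ M a → OutsideGap c₂ M b → c₁ + c₂ < M →
             OutsideGap (c₁ + c₂) M (a +* b) × truncate M (a +* b) ≡ truncate M a +* truncate M b
truncate-+ {c₁} {c₂} (below {k₁} k₁≤c₁) (below {k₂} k₂≤c₂) c₁+c₂<M =
  below sum≤ ,
  trans (truncate-fin (≤-<-trans sum≤ c₁+c₂<M))
        (sym (cong₂ _+*_ (truncate-fin (≤-<-trans (≤-trans (m≤m+n k₁ k₂) sum≤) c₁+c₂<M))
                         (truncate-fin (≤-<-trans (≤-trans (m≤n+m k₂ k₁) sum≤) c₁+c₂<M))))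
  where sum≤ = +-mono-≤ k₁≤c₁ k₂≤c₂
truncate-+ {b = b} (above l) _ _ =
  above (large-+ˡ l b) , trans (truncate-large (large-+ˡ l b)) (cong (_+* truncate _ b) (sym (truncate-large l)))
truncate-+ {M = M} {a} (below _) (above l) _ =
  above (large-+ʳ a l) ,
  trans (truncate-large (large-+ʳ a l)) (sym (trans (cong (truncate M a +*_) (truncate-large l)) (+*-∞ʳ _)))

truncate-·-nonzero : ∀ {c₁ c₂ M a b} → a ≢ fin 0 → b ≢ fin 0 →
                     OutsideGap c₁ M a → OutsideGap c₂ M b → c₁ * c₂ < M →
                     OutsideGap (c₁ * c₂) M (a ·* b) × truncate M (a ·* b) ≡ truncate M a ·* truncate M b
truncate-·-nonzero a≢0 b≢0 (below {k₁} k₁≤c₁) (below {k₂} k₂≤c₂) c₁c₂<M =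
  below prod≤ ,
  trans (truncate-fin (≤-<-trans prod≤ c₁c₂<M))
        (sym (cong₂ _·*_ (truncate-fin (≤-<-trans (≤-trans (m≤m*n k₁ k₂ {{k₂≢0}}) prod≤) c₁c₂<M))
                         (truncate-fin (≤-<-trans (≤-trans (m≤n*m k₂ k₁ {{k₁≢0}}) prod≤) c₁c₂<M))))
  where
    prod≤ = *-mono-≤ k₁≤c₁ k₂≤c₂
    k₁≢0 = ≢-nonZero (a≢0 ∘ cong fin)
    k₂≢0 = ≢-nonZero (b≢0 ∘ cong fin)
truncate-·-nonzero {M = M} {b = b} _ b≢0 (above l) _ _ =
  above (large-·ˡ l b≢0) ,
  trans (truncate-large (large-·ˡ l b≢0))
        (sym (trans (cong (_·* truncate M b) (truncate-large l)) (·*-∞ˡ (truncate-≢0 b≢0))))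
truncate-·-nonzero {M = M} {a = a} a≢0 _ (below _) (above l) _ =
  above (large-·ʳ a≢0 l) ,
  trans (truncate-large (large-·ʳ a≢0 l))
        (sym (trans (cong (truncate M a ·*_) (truncate-large l)) (·*-∞ʳ (truncate-≢0 a≢0))))

truncate-· : ∀ {c₁ c₂ M a b} → OutsideGap c₁ M a → OutsideGap c₂ M b → c₁ * c₂ < M →
             OutsideGap (c₁ * c₂) M (a ·* b) × truncate M (a ·* b) ≡ truncate M a ·* truncate M b
truncate-· {M = M} {a} {b} ga gb c₁c₂<M with a ≟* fin 0 | b ≟* fin 0
... | yes refl | _ =
  subst (OutsideGap _ M) (sym (·*-zeroˡ b)) (below z≤n) ,
  trans (trans (cong (truncate M) (·*-zeroˡ b)) truncate-0)
        (sym (trans (cong (_·* truncate M b) truncate-0) (·*-zeroˡ _)))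
  where truncate-0 = truncate-fin (≤-<-trans z≤n c₁c₂<M)
... | no _ | yes refl =
  subst (OutsideGap _ M) (sym (·*-zeroʳ a)) (below z≤n) ,
  trans (trans (cong (truncate M) (·*-zeroʳ a)) truncate-0)
        (sym (trans (cong (truncate M a ·*_) truncate-0) (·*-zeroʳ _)))
  where truncate-0 = truncate-fin (≤-<-trans z≤n c₁c₂<M)
... | no a≢0 | no b≢0 = truncate-·-nonzero a≢0 b≢0 ga gb c₁c₂<M

-- The extra summands in the product case make the bound dominate those of both factors.
valueBound : ℕ → Term → ℕ
valueBound c (var v)  = c
valueBound c `0       = 0
valueBound c (`S t)   = suc (valueBound c t)
valueBound c (s `+ t) = valueBound c s + valueBound c t
valueBound c (s `· t) = valueBound c s * valueBound c t + (valueBound c s + valueBound c t)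

truncate-eval : ∀ {c M} ρ t → (∀ v → OccT v t → OutsideGap c M (ρ v)) → valueBound c t < M →
                OutsideGap (valueBound c t) M (eval* ρ t) × truncate M (eval* ρ t) ≡ eval* (truncate M ∘ ρ) t
truncate-eval ρ (var v) outside _ = outside v refl , refl
truncate-eval ρ `0 _ 0<M = below z≤n , truncate-fin 0<M
truncate-eval ρ (`S t) outside bound<M
  with truncate-eval ρ t outside (<-trans (n<1+n _) bound<M)
... | gt , et = Product.map₂ (λ e → trans e (cong S* et)) (truncate-S gt bound<M)
truncate-eval {c} ρ (s `+ t) outside bound<M
  with truncate-eval ρ s (λ v → outside v ∘ inj₁) (≤-<-trans (m≤m+n _ _) bound<M)
     | truncate-eval ρ t (λ v → outside v ∘ inj₂) (≤-<-trans (m≤n+m _ _) bound<M)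
... | gs , es | gt , et = Product.map₂ (λ e → trans e (cong₂ _+*_ es et)) (truncate-+ gs gt bound<M)
truncate-eval {c} ρ (s `· t) outside bound<M
  with truncate-eval ρ s (λ v → outside v ∘ inj₁) (≤-<-trans bs≤ bound<M)
     | truncate-eval ρ t (λ v → outside v ∘ inj₂) (≤-<-trans bt≤ bound<M)
  where bs = valueBound c s
        bt = valueBound c t
        bs≤ = ≤-trans (m≤m+n bs bt) (m≤n+m _ (bs * bt))
        bt≤ = ≤-trans (m≤n+m bt bs) (m≤n+m _ (bs * bt))
... | gs , es | gt , et =
  Product.map (outsideGap-weaken (m≤m+n _ _)) (λ e → trans e (cong₂ _·*_ es et))
              (truncate-· gs gt (≤-<-trans (m≤m+n _ _) bound<M))

sumEquations : (Term → ℕ) → BForm → ℕ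
sumEquations f (beq s t)   = f s + f t
sumEquations f b⊤          = 0
sumEquations f b⊥          = 0
sumEquations f (A b∧ B)    = sumEquations f A + sumEquations f B
sumEquations f (A b∨ B)    = sumEquations f A + sumEquations f B
sumEquations f (b∃ x A)    = sumEquations f A
sumEquations f (b∀ xs A B) = sumEquations f A + sumEquations f B

Witnessed : BForm → Env ℕ* → Set
Witnessed (beq s t)   ρ = eval* ρ s ≡ eval* ρ t
Witnessed b⊤          ρ = ⊤
Witnessed b⊥          ρ = ⊥
Witnessed (A b∧ B)    ρ = Witnessed A ρ × Witnessed B ρ
Witnessed (A b∨ B)    ρ = Witnessed A ρ ⊎ Witnessed B ρ
Witnessed (b∃ x A)    ρ = ∃[ d ] Witnessed A (ρ [ x ↦ d ])
Witnessed (b∀ xs A B) ρ = ⊤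

⊩⇒¬¬witnessed : ∀ A ρ → ρ ⊩ A → ¬ ¬ Witnessed A ρ
⊩⇒¬¬witnessed (beq s t)   ρ s≡t = λ ¬w → ¬w s≡t
⊩⇒¬¬witnessed b⊤          ρ _ = λ ¬w → ¬w tt
⊩⇒¬¬witnessed b⊥          ρ ()
⊩⇒¬¬witnessed (A b∧ B)    ρ (a , b) ¬w =
  ⊩⇒¬¬witnessed A ρ a λ wa → ⊩⇒¬¬witnessed B ρ b λ wb → ¬w (wa , wb)
⊩⇒¬¬witnessed (A b∨ B)    ρ ¬¬a∨b ¬w =
  ¬¬a∨b ((λ a → ⊩⇒¬¬witnessed A ρ a (¬w ∘ inj₁)) , (λ b → ⊩⇒¬¬witnessed B ρ b (¬w ∘ inj₂)))
⊩⇒¬¬witnessed (b∃ x A)    ρ ¬¬∃ ¬w =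
  ¬¬∃ λ d a → ⊩⇒¬¬witnessed A (ρ [ x ↦ d ]) a (¬w ∘ (d ,_))
⊩⇒¬¬witnessed (b∀ xs A B) ρ _ = λ ¬w → ¬w tt

witnesses : ∀ A ρ → Witnessed A ρ → List ℕ*
witnesses (beq s t)   ρ _        = []
witnesses b⊤          ρ _        = []
witnesses (A b∧ B)    ρ (a , b)  = witnesses A ρ a ++ witnesses B ρ b
witnesses (A b∨ B)    ρ (inj₁ a) = witnesses A ρ a
witnesses (A b∨ B)    ρ (inj₂ b) = witnesses B ρ b
witnesses (b∃ x A)    ρ (d , a)  = d ∷ witnesses A (ρ [ x ↦ d ]) a
witnesses (b∀ xs A B) ρ _        = []

existentials : BForm → ℕ
existentials (A b∧ B) = existentials A + existentials B
existentials (A b∨ B) = existentials A + existentials B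
existentials (b∃ x A) = suc (existentials A)
existentials _        = 0

witnesses-length : ∀ A ρ w → length (witnesses A ρ w) ≤ existentials A
witnesses-length (beq s t)   ρ _        = z≤n
witnesses-length b⊤          ρ _        = z≤n
witnesses-length (A b∧ B)    ρ (a , b)  = begin
  length (witnesses A ρ a ++ witnesses B ρ b)             ≡⟨ length-++ (witnesses A ρ a) ⟩
  length (witnesses A ρ a) + length (witnesses B ρ b)     ≤⟨ +-mono-≤ (witnesses-length A ρ a)
                                                                       (witnesses-length B ρ b) ⟩
  existentials A + existentials B                         ∎
  where open ≤-Reasoning
witnesses-length (A b∨ B)    ρ (inj₁ a) = ≤-trans (witnesses-length A ρ a) (m≤m+n _ _)
witnesses-length (A b∨ B)    ρ (inj₂ b) = ≤-trans (witnesses-length B ρ b) (m≤n+m _ _)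
witnesses-length (b∃ x A)    ρ (d , a)  = s≤s (witnesses-length A _ a)
witnesses-length (b∀ xs A B) ρ _        = z≤n

truncate-⊩ : ∀ A ρ {c M} (w : Witnessed A ρ) → All (OutsideGap c M) (witnesses A ρ w) →
             (∀ v → FreeB v A → OutsideGap c M (ρ v)) → sumEquations (valueBound c) A < M →
             truncate M ∘ ρ ⊩ A
truncate-⊩ (beq s t) ρ s≡t _ outside bound<M =
  trans (sym (proj₂ (truncate-eval ρ s (λ v → outside v ∘ inj₁) (≤-<-trans (m≤m+n _ _) bound<M))))
        (trans (cong (truncate _) s≡t)
               (proj₂ (truncate-eval ρ t (λ v → outside v ∘ inj₂) (≤-<-trans (m≤n+m _ _) bound<M))))
truncate-⊩ b⊤ ρ _ _ _ _ = tt
truncate-⊩ (A b∧ B) ρ (a , b) ws outside bound<M =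
  truncate-⊩ A ρ a (proj₁ (++⁻ _ ws)) (λ v → outside v ∘ inj₁) (≤-<-trans (m≤m+n _ _) bound<M) ,
  truncate-⊩ B ρ b (proj₂ (++⁻ _ ws)) (λ v → outside v ∘ inj₂) (≤-<-trans (m≤n+m _ _) bound<M)
truncate-⊩ (A b∨ B) ρ (inj₁ a) ws outside bound<M (¬a , _) =
  ¬a (truncate-⊩ A ρ a ws (λ v → outside v ∘ inj₁) (≤-<-trans (m≤m+n _ _) bound<M))
truncate-⊩ (A b∨ B) ρ (inj₂ b) ws outside bound<M (_ , ¬b) =
  ¬b (truncate-⊩ B ρ b ws (λ v → outside v ∘ inj₂) (≤-<-trans (m≤n+m _ _) bound<M))
truncate-⊩ (b∃ y A) ρ {c} {M} (d , a) (d-outside ∷ ws) outside bound<M ¬∃ =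
  ¬∃ (truncate M d) (⊩-cong A (update-map (truncate M) ρ y d)
                              (truncate-⊩ A (ρ [ y ↦ d ]) a ws outside′ bound<M))
  where
    outside′ : ∀ v → FreeB v A → OutsideGap c M ((ρ [ y ↦ d ]) v)
    outside′ v v∈A = update-elim (OutsideGap c M) ρ y d v (λ _ → d-outside) (λ v≢y → outside v (v≢y , v∈A))
truncate-⊩ (b∀ xs A B) ρ _ _ _ _ _ ()

increasing⇒monotone : (T : ℕ → ℕ) → (∀ i → T i < T (suc i)) → ∀ {i j} → i ≤ j → T i ≤ T j
increasing⇒monotone T increasing {j = zero}  z≤n = ≤-refl
increasing⇒monotone T increasing {j = suc j} i≤1+j with m≤n⇒m<n∨m≡n i≤1+j
... | inj₁ (s≤s i≤j) = ≤-trans (increasing⇒monotone T increasing i≤j) (<⇒≤ (increasing j))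
... | inj₂ refl      = ≤-refl

outsideGap-or-below : ∀ c M d → OutsideGap c M d ⊎ ∃[ k ] d ≡ fin k × k < M
outsideGap-or-below c M ∞ = inj₁ (above ∞-large)
outsideGap-or-below c M (fin k) with k ≤? c | M ≤? k
... | yes k≤c | _       = inj₁ (below k≤c)
... | no _    | yes M≤k = inj₁ (above (fin-large M≤k))
... | no _    | no M≰k  = inj₂ (k , refl , ≰⇒> M≰k)

-- Each new witness spoils at most the gap found for the others, so 2 ^ n consecutive gaps suffice.
gap-avoiding : (T : ℕ → ℕ) → (∀ i → T i < T (suc i)) → ∀ L j →
               ∃[ i ] j ≤ i × i < j + 2 ^ length L × All (OutsideGap (T i) (T (suc i))) L
gap-avoiding T increasing [] j = j , ≤-refl , m<m+n j z<s , []
gap-avoiding T increasing (d ∷ L) j with gap-avoiding T increasing L j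
... | i₀ , j≤i₀ , i₀<j+p , ws₀ with outsideGap-or-below (T i₀) (T (suc i₀)) d
...   | inj₁ d-outside = i₀ , j≤i₀ , <-≤-trans i₀<j+p (+-monoʳ-≤ j (m≤m+n _ _)) , d-outside ∷ ws₀
...   | inj₂ (k , refl , k<T[1+i₀]) with gap-avoiding T increasing L (suc i₀)
...     | i₁ , i₀<i₁ , i₁<1+i₀+p , ws₁ =
  i₁ , ≤-trans j≤i₀ (<⇒≤ i₀<i₁) , i₁<j+2p ,
  below (≤-trans (<⇒≤ k<T[1+i₀]) (increasing⇒monotone T increasing i₀<i₁)) ∷ ws₁
  where
    p = 2 ^ length L
    open ≤-Reasoning
    i₁<j+2p : i₁ < j + 2 ^ suc (length L)
    i₁<j+2p = begin-strict
      i₁               <⟨ i₁<1+i₀+p ⟩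
      suc i₀ + p       ≤⟨ +-monoˡ-≤ p i₀<j+p ⟩
      (j + p) + p      ≡⟨ +-assoc j p p ⟩
      j + (p + p)      ≡⟨ cong (λ q → j + (p + q)) (+-identityʳ p) ⟨
      j + 2 ^ suc (length L) ∎

finitePart : ℕ* → ℕ
finitePart (fin k) = k
finitePart ∞       = 0

outsideGap-finitePart : ∀ {c M d} → finitePart d ≤ c → OutsideGap c M d
outsideGap-finitePart {d = fin k} k≤c = below k≤c
outsideGap-finitePart {d = ∞}     _   = above ∞-large

truncate-finitePart : ∀ {M d} → finitePart d < M → truncate M d ≡ d
truncate-finitePart {d = fin k} k<M = truncate-fin k<M
truncate-finitePart {d = ∞}     _   = refl

occurrenceSum : Env ℕ → Term → ℕ
occurrenceSum e (var v)  = e v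
occurrenceSum e `0       = 0
occurrenceSum e (`S t)   = occurrenceSum e t
occurrenceSum e (s `+ t) = occurrenceSum e s + occurrenceSum e t
occurrenceSum e (s `· t) = occurrenceSum e s + occurrenceSum e t

occurrenceSum-≥ : ∀ e t {v} → OccT v t → e v ≤ occurrenceSum e t
occurrenceSum-≥ e (var v)  refl       = ≤-refl
occurrenceSum-≥ e (`S t)   v∈t        = occurrenceSum-≥ e t v∈t
occurrenceSum-≥ e (s `+ t) (inj₁ v∈s) = ≤-trans (occurrenceSum-≥ e s v∈s) (m≤m+n _ _)
occurrenceSum-≥ e (s `+ t) (inj₂ v∈t) = ≤-trans (occurrenceSum-≥ e t v∈t) (m≤n+m _ _)
occurrenceSum-≥ e (s `· t) (inj₁ v∈s) = ≤-trans (occurrenceSum-≥ e s v∈s) (m≤m+n _ _)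
occurrenceSum-≥ e (s `· t) (inj₂ v∈t) = ≤-trans (occurrenceSum-≥ e t v∈t) (m≤n+m _ _)

sumEquations-≥ : ∀ f A {v n} → (∀ t → OccT v t → n ≤ f t) → FreeB v A → n ≤ sumEquations f A
sumEquations-≥ f (beq s t)   ≤f (inj₁ v∈s)      = ≤-trans (≤f s v∈s) (m≤m+n _ _)
sumEquations-≥ f (beq s t)   ≤f (inj₂ v∈t)      = ≤-trans (≤f t v∈t) (m≤n+m _ _)
sumEquations-≥ f (A b∧ B)    ≤f (inj₁ v∈A)      = ≤-trans (sumEquations-≥ f A ≤f v∈A) (m≤m+n _ _)
sumEquations-≥ f (A b∧ B)    ≤f (inj₂ v∈B)      = ≤-trans (sumEquations-≥ f B ≤f v∈B) (m≤n+m _ _)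
sumEquations-≥ f (A b∨ B)    ≤f (inj₁ v∈A)      = ≤-trans (sumEquations-≥ f A ≤f v∈A) (m≤m+n _ _)
sumEquations-≥ f (A b∨ B)    ≤f (inj₂ v∈B)      = ≤-trans (sumEquations-≥ f B ≤f v∈B) (m≤n+m _ _)
sumEquations-≥ f (b∃ x A)    ≤f (_ , v∈A)       = sumEquations-≥ f A ≤f v∈A
sumEquations-≥ f (b∀ xs A B) ≤f (_ , inj₁ v∈A) = ≤-trans (sumEquations-≥ f A ≤f v∈A) (m≤m+n _ _)
sumEquations-≥ f (b∀ xs A B) ≤f (_ , inj₂ v∈B) = ≤-trans (sumEquations-≥ f B ≤f v∈B) (m≤n+m _ _)

module OmegaRule (A : BForm) (x : ℕ) (ρ : Env ℕ*) where

  parameterBound : ℕ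
  parameterBound = sumEquations (occurrenceSum (finitePart ∘ ρ)) A

  parameter-≤ : ∀ v → FreeB v A → finitePart (ρ v) ≤ parameterBound
  parameter-≤ v = sumEquations-≥ _ A (λ t → occurrenceSum-≥ (finitePart ∘ ρ) t)

  level : ℕ → ℕ
  level zero    = parameterBound
  level (suc i) = suc (sumEquations (valueBound (level i)) A + level i)

  level-increasing : ∀ i → level i < level (suc i)
  level-increasing i = s≤s (m≤n+m _ _)

  level-monotone : ∀ {i j} → i ≤ j → level i ≤ level j
  level-monotone = increasing⇒monotone level level-increasing

  N : ℕ
  N = level (2 ^ existentials A)

  witnessed-N⇒⊩-∞ : Witnessed A (ρ [ x ↦ fin N ]) → ρ [ x ↦ ∞ ] ⊩ A
  witnessed-N⇒⊩-∞ w with gap-avoiding level level-increasing (witnesses A (ρ [ x ↦ fin N ]) w) 0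
  ... | i , _ , i<2^n , ws = ⊩-agree A truncation-agrees
                               (truncate-⊩ A (ρ [ x ↦ fin N ]) w ws outside (s≤s (m≤m+n _ _)))
    where
      M = level (suc i)
      M≤N : M ≤ N
      M≤N = level-monotone (<-≤-trans i<2^n (^-monoʳ-≤ 2 (witnesses-length A _ w)))
      parameter-≤-level : ∀ v → FreeB v A → finitePart (ρ v) ≤ level i
      parameter-≤-level v v∈A = ≤-trans (parameter-≤ v v∈A) (level-monotone {j = i} z≤n)
      outside : ∀ v → FreeB v A → OutsideGap (level i) M ((ρ [ x ↦ fin N ]) v)
      outside v v∈A = update-elim (OutsideGap (level i) M) ρ x (fin N) v
        (λ _ → above (fin-large M≤N)) (λ _ → outsideGap-finitePart (parameter-≤-level v v∈A))
      truncation-agrees : ∀ v → FreeB v A → truncate M ((ρ [ x ↦ fin N ]) v) ≡ (ρ [ x ↦ ∞ ]) v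
      truncation-agrees v v∈A = update-elim₂ (λ a b → truncate M a ≡ b) ρ ρ x (fin N) ∞ v
        (λ _ → truncate-large (fin-large M≤N))
        (λ _ → truncate-finitePart (≤-<-trans (parameter-≤-level v v∈A) (level-increasing i)))

⊩-∞ : ∀ A x ρ → (∀ n → ρ [ x ↦ fin n ] ⊩ A) → ρ [ x ↦ ∞ ] ⊩ A
⊩-∞ A x ρ finite = ⊩-stable A _ (¬¬-map witnessed-N⇒⊩-∞ (⊩⇒¬¬witnessed A _ (finite N)))
  where open OmegaRule A x ρ

ℕ*-induction : ∀ A x ρ → ρ [ x ↦ fin 0 ] ⊩ A → (∀ d → ρ [ x ↦ d ] ⊩ A → ρ [ x ↦ S* d ] ⊩ A) →
               ∀ d → ρ [ x ↦ d ] ⊩ A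
ℕ*-induction A x ρ base step = every
  where
    finite : ∀ n → ρ [ x ↦ fin n ] ⊩ A
    finite zero    = base
    finite (suc n) = step (fin n) (finite n)
    every : ∀ d → ρ [ x ↦ d ] ⊩ A
    every (fin n) = finite n
    every ∞       = ⊩-∞ A x ρ finite

eval-sg-S : ∀ ρ x d → eval* (ρ [ x ↦ d ]) ∘ sg x (`S (var x)) ≗ ρ [ x ↦ S* d ]
eval-sg-S ρ x d v = begin
  eval* (ρ [ x ↦ d ]) (sg x (`S (var x)) v)       ≡⟨ eval-sg (ρ [ x ↦ d ]) x (`S (var x)) v ⟩
  ((ρ [ x ↦ d ]) [ x ↦ S* ((ρ [ x ↦ d ]) x) ]) v  ≡⟨ update-update ρ x d _ v ⟩
  (ρ [ x ↦ S* ((ρ [ x ↦ d ]) x) ]) v              ≡⟨ cong (λ e → (ρ [ x ↦ S* e ]) v) (update-same ρ x d) ⟩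
  (ρ [ x ↦ S* d ]) v                              ∎
  where open ≡-Reasoning

⊩-induction : ∀ A x ρ → ρ ⊩ substB (sg x `0) A →
              (∀ d → ρ [ x ↦ d ] ⊩ A → ρ [ x ↦ d ] ⊩ substB (sg x (`S (var x))) A) →
              ∀ d → ρ [ x ↦ d ] ⊩ A
⊩-induction A x ρ base step = ℕ*-induction A x ρ
  (⊩-cong A (eval-sg ρ x `0) (to (⊩-subst A _ ρ freeFor-0) base))
  (λ d → ⊩-cong A (eval-sg-S ρ x d) ∘ to (⊩-subst A _ _ freeFor-S) ∘ step d)
  where
    freeFor-0 = local⇒freeFor A (sg x `0) (local-sg x `0 λ _ ())
    freeFor-S = local⇒freeFor A (sg x (`S (var x))) (local-sg x (`S (var x)) λ _ → id)

Entails : BForm → BForm → Set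
Entails A B = ∀ ρ → ρ ⊩ A → ρ ⊩ B

entails⇒forcesSeq : ∀ {A B} → Entails A B → ForcesSeq tt (A ⇒ B)
entails⇒forcesSeq A⊩B tt _ = A⊩B

forcesSeq⇒entails : ∀ A B → ForcesSeq tt (A ⇒ B) → Entails A B
forcesSeq⇒entails A B A⇒B = A⇒B tt (inj₁ refl)

⊩-b∀ : ∀ ρ xs A B → ρ ⊩ b∀ xs A B
⊩-b∀ ρ xs A B _ ()

⊩-subst-equal-vars : ∀ x y {A} → IsAtomB A → ∀ ρ → ρ x ≡ ρ y → ρ ⊩ A → ρ ⊩ substB (sg x (var y)) A
⊩-subst-equal-vars x y (at-eq s t) ρ x≡y =
  from (⊩-subst (beq s t) (sg x (var y)) ρ tt) ∘ ⊩-cong (beq s t) ρ≗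
  where
    ρ≗ : ρ ≗ eval* ρ ∘ sg x (var y)
    ρ≗ v = trans (sym (update-self ρ x v))
                 (trans (cong (λ e → (ρ [ x ↦ e ]) v) x≡y) (sym (eval-sg ρ x (var y) v)))
⊩-subst-equal-vars x y at-⊤ ρ _ _ = tt
⊩-subst-equal-vars x y at-⊥ ρ _ ()

axiom-sound : ∀ {A B} → BAx (A ⇒ B) → Entails A B
axiom-sound (ax-id A)       ρ = id
axiom-sound (ax-⊤ A)        ρ _ = tt
axiom-sound (ax-⊥ A)        ρ ()
axiom-sound (ax-dist A B C) ρ (a , b∨c) = classical-∨-map (a ,_) (a ,_) b∨c
axiom-sound (ax-∧∃ A x B x∉A) ρ (a , ∃b) = flip classical-∃-map ∃b λ d →
  ⊩-agree A (λ v v∈A → sym (update-other ρ x d v λ { refl → x∉A v∈A })) a ,_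
axiom-sound (ax-refl x)     ρ _ = refl
axiom-sound (ax-eq x y A atom) ρ (x≡y , a) = ⊩-subst-equal-vars x y atom ρ x≡y a
axiom-sound (ax-tr xs A B C)  ρ _ = ⊩-b∀ ρ xs A C
axiom-sound (ax-∧ xs A B C)   ρ _ = ⊩-b∀ ρ xs A (B b∧ C)
axiom-sound (ax-∨ xs A B C)   ρ _ = ⊩-b∀ ρ xs (B b∨ C) A
axiom-sound (ax-sub xs ts A B _ _ _) ρ _ = ⊩-b∀ ρ xs _ _
axiom-sound (ax-gen xs ys A B _)     ρ _ = ⊩-b∀ ρ ys A B
axiom-sound (ax-∃ ys x B A _)        ρ _ = ⊩-b∀ ρ ys (b∃ x B) A
axiom-sound ax-S0 ρ = S*≢0 (ρ 0)
axiom-sound ax-SS ρ = S*-injective (ρ 0) (ρ 1)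
axiom-sound ax-+0 ρ _ = +*-identityʳ (ρ 0)
axiom-sound ax-+S ρ _ = +*-suc (ρ 0) (ρ 1)
axiom-sound ax-·0 ρ _ = ·*-zeroʳ (ρ 0)
axiom-sound ax-·S ρ _ = ·*-suc (ρ 0) (ρ 1)
axiom-sound (ax-ind ys x A) ρ _ = ⊩-b∀ ρ (ys ++ x ∷ []) _ A

rule-sound : ∀ {ps A B} → BRule ps (A ⇒ B) → All (ForcesSeq tt) ps → Entails A B
rule-sound (r-tr A B C) (A⇒B ∷ B⇒C ∷ []) ρ =
  forcesSeq⇒entails B C B⇒C ρ ∘ forcesSeq⇒entails A B A⇒B ρ
rule-sound (r-∧I A B C) (A⇒B ∷ A⇒C ∷ []) ρ a =
  forcesSeq⇒entails A B A⇒B ρ a , forcesSeq⇒entails A C A⇒C ρ a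
rule-sound (r-∧E₁ A B C) (A⇒B∧C ∷ []) ρ = proj₁ ∘ forcesSeq⇒entails A (B b∧ C) A⇒B∧C ρ
rule-sound (r-∧E₂ A B C) (A⇒B∧C ∷ []) ρ = proj₂ ∘ forcesSeq⇒entails A (B b∧ C) A⇒B∧C ρ
rule-sound (r-∨I A B C) (B⇒A ∷ C⇒A ∷ []) ρ ¬¬b∨c = ⊩-stable A ρ λ ¬a →
  ¬¬b∨c (¬a ∘ forcesSeq⇒entails B A B⇒A ρ , ¬a ∘ forcesSeq⇒entails C A C⇒A ρ)
rule-sound (r-∨E₁ A B C) (B∨C⇒A ∷ []) ρ b = forcesSeq⇒entails (B b∨ C) A B∨C⇒A ρ λ (¬b , _) → ¬b b
rule-sound (r-∨E₂ A B C) (B∨C⇒A ∷ []) ρ c = forcesSeq⇒entails (B b∨ C) A B∨C⇒A ρ λ (_ , ¬c) → ¬c c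
rule-sound (r-sub A B x t ffA ffB) (A⇒B ∷ []) ρ =
  from (⊩-subst B _ ρ ffB) ∘ forcesSeq⇒entails A B A⇒B _ ∘ to (⊩-subst A _ ρ ffA)
rule-sound (r-∃I x B A x∉A) (B⇒A ∷ []) ρ ¬¬∃ = ⊩-stable A ρ λ ¬a → ¬¬∃ λ d →
  ¬a ∘ ⊩-agree A (λ v v∈A → update-other ρ x d v λ { refl → x∉A v∈A }) ∘ forcesSeq⇒entails B A B⇒A _
rule-sound (r-∃E x B A _) (∃B⇒A ∷ []) ρ b =
  forcesSeq⇒entails (b∃ x B) A ∃B⇒A ρ λ ¬∃ → ¬∃ (ρ x) (⊩-cong B (sym ∘ update-self ρ x) b)
rule-sound (r-∀I xs A B C _) _ ρ _ = ⊩-b∀ ρ xs B C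
rule-sound (r-ind x A) (A⇒A[Sx] ∷ []) ρ base =
  ⊩-cong A (update-self ρ x) (⊩-induction A x ρ base (λ _ → forcesSeq⇒entails A _ A⇒A[Sx] _) (ρ x))

K*-models-BA : ModelOfBA K*
K*-models-BA tt =
  (λ { (A ⇒ B) ax → entails⇒forcesSeq (axiom-sound ax) }) ,
  (λ { ps (A ⇒ B) rule tt _ premises → entails⇒forcesSeq (rule-sound rule premises) })

-- Implications and universal formulas cannot occur in ∃₁⁺ formulas, so their translation is arbitrary.
toBasic : CForm → BForm
toBasic (ceq s t) = beq s t
toBasic c⊥        = b⊥
toBasic (A c∧ B)  = toBasic A b∧ toBasic B
toBasic (A c∨ B)  = toBasic A b∨ toBasic B
toBasic (A c⇒ B)  = b⊤
toBasic (c∀ x A)  = b⊤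
toBasic (c∃ x A)  = b∃ x (toBasic A)

toBasic-subst : ∀ σ A → toBasic (substC σ A) ≡ substB σ (toBasic A)
toBasic-subst σ (ceq s t) = refl
toBasic-subst σ c⊥        = refl
toBasic-subst σ (A c∧ B)  = cong₂ _b∧_ (toBasic-subst σ A) (toBasic-subst σ B)
toBasic-subst σ (A c∨ B)  = cong₂ _b∨_ (toBasic-subst σ A) (toBasic-subst σ B)
toBasic-subst σ (A c⇒ B)  = refl
toBasic-subst σ (c∀ x A)  = refl
toBasic-subst σ (c∃ x A)  = cong (b∃ x) (toBasic-subst (σ ⟨ x ∷ [] ⟩) A)

posQF-subst : ∀ σ {A} → PosQF A → PosQF (substC σ A)
posQF-subst σ (pq-eq s t) = pq-eq _ _
posQF-subst σ (pq-∧ a b)  = pq-∧ (posQF-subst σ a) (posQF-subst σ b)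
posQF-subst σ (pq-∨ a b)  = pq-∨ (posQF-subst σ a) (posQF-subst σ b)

isE1+-subst : ∀ σ {A} → IsE1+ A → IsE1+ (substC σ A)
isE1+-subst σ (e-base p)  = e-base (posQF-subst σ p)
isE1+-subst σ (e-ex x e)  = e-ex x (isE1+-subst _ e)

posQF-sat⇔⊩ : ∀ {A} → PosQF A → ∀ ρ → Sat ℕ*ops A ρ ⇔ ρ ⊩ toBasic A
posQF-sat⇔⊩ (pq-eq s t) ρ = mk⇔ id id
posQF-sat⇔⊩ (pq-∧ a b)  ρ = mk⇔
  (Product.map (to (posQF-sat⇔⊩ a ρ)) (to (posQF-sat⇔⊩ b ρ)))
  (Product.map (from (posQF-sat⇔⊩ a ρ)) (from (posQF-sat⇔⊩ b ρ)))
posQF-sat⇔⊩ (pq-∨ a b)  ρ = mk⇔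
  (classical-∨-map (to (posQF-sat⇔⊩ a ρ)) (to (posQF-sat⇔⊩ b ρ)))
  (classical-∨-map (from (posQF-sat⇔⊩ a ρ)) (from (posQF-sat⇔⊩ b ρ)))

isE1+-sat⇔⊩ : ∀ {A} → IsE1+ A → ∀ ρ → Sat ℕ*ops A ρ ⇔ ρ ⊩ toBasic A
isE1+-sat⇔⊩ (e-base p) ρ = posQF-sat⇔⊩ p ρ
isE1+-sat⇔⊩ (e-ex x e) ρ = mk⇔
  (classical-∃-map λ d → to (isE1+-sat⇔⊩ e (ρ [ x ↦ d ])))
  (classical-∃-map λ d → from (isE1+-sat⇔⊩ e (ρ [ x ↦ d ])))

sat-subst⇒⊩ : ∀ σ {A} → IsE1+ A → ∀ ρ → Sat ℕ*ops (substC σ A) ρ → ρ ⊩ substB σ (toBasic A)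
sat-subst⇒⊩ σ {A} e ρ = subst (ρ ⊩_) (toBasic-subst σ A) ∘ to (isE1+-sat⇔⊩ (isE1+-subst σ e) ρ)

Q-sound : ∀ φ → QAx φ → ∀ ρ → Sat ℕ*ops φ ρ
Q-sound _ q1 ρ = S*≢0 (ρ 0)
Q-sound _ q2 ρ = S*-injective (ρ 0) (ρ 1)
Q-sound _ q3 ρ = +*-identityʳ (ρ 0)
Q-sound _ q4 ρ = +*-suc (ρ 0) (ρ 1)
Q-sound _ q5 ρ = ·*-zeroʳ (ρ 0)
Q-sound _ q6 ρ = ·*-suc (ρ 0) (ρ 1)
Q-sound _ q7 ρ (≢0 , ¬¬≢S) with zero-or-S* (ρ 0)
... | inj₁ ≡0       = ≢0 ≡0
... | inj₂ (b , ≡S) = ¬¬≢S λ ≢S → ≢S b ≡S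

induction-sound : ∀ A x → IsE1+ A → ∀ ρ → Sat ℕ*ops (Ind A x) ρ
induction-sound A x e ρ (base , step) =
  from (isE1+-sat⇔⊩ e _) ∘ ⊩-induction (toBasic A) x ρ (sat-subst⇒⊩ (sg x `0) e ρ base)
    (λ d → sat-subst⇒⊩ (sg x (`S (var x))) e _ ∘ step d ∘ from (isE1+-sat⇔⊩ e _))

ℕ*-models-IE1+ : ModelOfIE1+ ℕ*ops
ℕ*-models-IE1+ = Q-sound , induction-sound

lemma3p14 : ModelOfIE1+ ℕ*ops × ModelOfBA K*
lemma3p14 = ℕ*-models-IE1+ , K*-models-BA
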